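{- For every nonempty finite set $S \subset \mathbb{Z}^+$, there exist infinitely many graphs which are chordal and Hamiltonian but not $S$-cycle extendible.
   Context: All graphs are simple, finite, connected and undirected. A graph is chordal if it has no induced cycle of length at least $4$. For a finite set $S \subset \mathbb{Z}^+$, a cycle $C$ of a graph $G$ is $S$-extendible if there is a cycle $C'$ in $G$ with $V(C) \subset V(C')$ and $|V(C')| - |V(C)| \in S$. A graph $G$ is $S$-cycle extendible if every cycle of $G$ that could be $S$-extendible (i.e. every cycle $C$ with $|V(C)| + s \leq |V(G)|$ for some $s \in S$) is $S$-extendible. -}

module Defs where

open import Data.Nat using (ℕ; zero; suc; _+_; _≤_; _<_; _<?_)
open import Data.Fin using (Fin; toℕ; fromℕ<)
open import Data.Bool using (Bool; true; false)
open import Data.List using (List)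
open import Data.List.Membership.Propositional using (_∈_)
open import Data.List.Relation.Unary.All using (All)
open import Data.Product using (Σ; ∃; _×_; _,_)
open import Data.Sum using (_⊎_)
open import Relation.Binary.PropositionalEquality using (_≡_)
open import Relation.Nullary using (¬_; yes; no)
open import Function.Definitions using (Injective)

record Graph (n : ℕ) : Set where
  field
    adj   : Fin n → Fin n → Bool
    sym   : ∀ u v → adj u v ≡ adj v u
    irrefl : ∀ v → adj v v ≡ false
open Graph public

data Reachable {n : ℕ} (G : Graph n) : Fin n → Fin n → Set where
  here : ∀ {v} → Reachable G v v
  step : ∀ {u v w} → adj G u v ≡ true → Reachable G v w → Reachable G u w

Connected : ∀ {n} → Graph n → Set
Connected {n} G = ∀ (u v : Fin n) → Reachable G u v

next : ∀ {m} → Fin (suc m) → Fin (suc m)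
next {m} i with suc (toℕ i) <? suc m
... | yes p = fromℕ< p
... | no _  = Fin.zero

record Cycle {n : ℕ} (G : Graph n) : Set where
  field
    m     : ℕ
    len≥3 : 3 ≤ suc m
    vtx   : Fin (suc m) → Fin n
    inj   : Injective _≡_ _≡_ vtx
    edges : ∀ i → adj G (vtx i) (vtx (next i)) ≡ true
open Cycle public

size : ∀ {n} {G : Graph n} → Cycle G → ℕ
size C = suc (m C)

_⊆V_ : ∀ {n} {G : Graph n} → Cycle G → Cycle G → Set
C ⊆V C' = ∀ i → ∃ λ j → vtx C' j ≡ vtx C i

Induced : ∀ {n} {G : Graph n} → Cycle G → Set
Induced {G = G} C = ∀ i j → adj G (vtx C i) (vtx C j) ≡ true → j ≡ next i ⊎ i ≡ next j

Chordal : ∀ {n} → Graph n → Set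
Chordal G = ∀ (C : Cycle G) → 4 ≤ size C → ¬ Induced C

Hamiltonian : ∀ {n} → Graph n → Set
Hamiltonian {n} G = Σ (Cycle G) λ C → size C ≡ n

SExtendible : ∀ {n} {G : Graph n} → List ℕ → Cycle G → Set
SExtendible {G = G} S C =
  Σ (Cycle G) λ C' → C ⊆V C' × ∃ λ s → s ∈ S × size C' ≡ size C + s

SCycleExtendible : ∀ {n} → List ℕ → Graph n → Set
SCycleExtendible {n} S G =
  ∀ (C : Cycle G) → (∃ λ s → s ∈ S × size C + s ≤ n) → SExtendible S C

-- The graph is a fixed 15-vertex core glued to a chain x₀ … xₖ whose ends hang from the core
-- vertices β (at x₀) and α (at xₖ), and three core "cones" κ₀ κ₁ κ₂ are adjacent to the whole
-- chain.  It is chordal because its six "ears" ε₀ … ε₅ have degree two with adjacent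
-- neighbours, the cones are adjacent to every non-ear, and what remains is a single path.
-- A cycle through all core vertices must use both edges at every ear.  This fixes the
-- cycle-neighbours of κ₁, κ₂ and δ, and forces the "switch" σ onto β or κ₀.  If σ takes κ₀,
-- every cone is saturated by core vertices, so the chain can only be entered at its two ends
-- and is traversed completely.  If σ takes β, the chain could only be entered and left
-- through κ₀ and α, whose other cycle-neighbour is ε₀; the chain would then close the short
-- cycle κ₀ … α ε₀ and miss σ.  So the 15-cycle on the core extends only by 0 or by k + 1
-- vertices, and k + 1 is chosen larger than every element of S.
module Submission where

open import Defs hiding (sym; m)
open import Data.Bool using (Bool; true; false; not; _∨_; T)
open import Data.Bool.Properties using (∨-comm) renaming (_≟_ to _≟ᵇ_)
open import Data.Empty using (⊥; ⊥-elim)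
open import Data.Fin using (Fin; zero; suc; toℕ; splitAt; join; _↑ˡ_; _↑ʳ_)
open import Data.Fin.Properties
  using (toℕ-fromℕ<; toℕ-injective; toℕ<n; _≟_; all?; any?; join-splitAt; splitAt-↑ˡ; splitAt-↑ʳ;
         toℕ-↑ʳ; ↑ˡ-injective; injective⇒≤)
open import Data.List using (List; []; _∷_)
open import Data.List.Membership.Propositional using (_∈_; _∉_)
open import Data.List.Membership.DecPropositional (_≟_ {15}) using (_∈?_)
open import Data.List.Relation.Unary.All using (All; tabulate) renaming (lookup to All-lookup)
open import Data.List.Relation.Unary.Any using (here; there)
open import Data.Nat using (ℕ; zero; suc; _+_; _∸_; _≤_; _<_; z≤n; s≤s; _<?_; _≤?_; _≡ᵇ_)
open import Data.Nat.DivMod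
  using (_%_; m<n⇒m%n≡m; n%n≡0; [m+n]%n≡m%n; %-distribˡ-+; m%n%n≡m%n; m≤n⇒[n∸m]%m≡n%m)
open import Data.Nat.ListAction using (sum)
open import Data.Nat.Properties hiding (_≟_)
open import Data.Product using (Σ; ∃; _×_; _,_; proj₁; proj₂)
open import Data.Sum using (_⊎_; inj₁; inj₂; [_,_]′)
open import Data.Sum.Properties using (≡-dec)
open import Data.Unit using (⊤)
open import Data.Vec using (Vec; lookup; []; _∷_)
open import Function using (_∘_; id)
open import Relation.Binary.PropositionalEquality
open import Relation.Nullary using (¬_; Dec; yes; no; ¬?; contradiction)
open import Relation.Nullary.Decidable using (True; toWitness; decidable-stable; from-yes; _→-dec_)

-- Cyclic successor

next^ : ∀ {m} → ℕ → Fin (suc m) → Fin (suc m)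
next^ zero    i = i
next^ (suc t) i = next (next^ t i)

prev : ∀ {m} → Fin (suc m) → Fin (suc m)
prev {m} = next^ m

toℕ-next : ∀ {m} (i : Fin (suc m)) → toℕ (next i) ≡ suc (toℕ i) % suc m
toℕ-next {m} i with suc (toℕ i) <? suc m
... | yes i+1<N = trans (toℕ-fromℕ< i+1<N) (sym (m<n⇒m%n≡m i+1<N))
... | no  i+1≮N = sym (trans (cong (_% suc m) i+1≡N) ([m+n]%n≡m%n 0 (suc m)))
  where
  i+1≡N : suc (toℕ i) ≡ suc m
  i+1≡N = ≤-antisym (toℕ<n i) (≮⇒≥ i+1≮N)

toℕ-next-< : ∀ {m} (i : Fin (suc m)) → suc (toℕ i) < suc m → toℕ (next i) ≡ suc (toℕ i)
toℕ-next-< i i+1<N = trans (toℕ-next i) (m<n⇒m%n≡m i+1<N)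

next-last : ∀ {m} (i : Fin (suc m)) → toℕ i ≡ m → next i ≡ zero
next-last {m} i i≡m =
  toℕ-injective (trans (toℕ-next i) (trans (cong (λ a → suc a % suc m) i≡m) (n%n≡0 (suc m))))

toℕ-next^ : ∀ {m} t (i : Fin (suc m)) → toℕ (next^ t i) ≡ (toℕ i + t) % suc m
toℕ-next^ {m} zero    i = sym (trans (cong (_% suc m) (+-identityʳ (toℕ i))) (m<n⇒m%n≡m (toℕ<n i)))
toℕ-next^ {m} (suc t) i = begin
  toℕ (next (next^ t i))                               ≡⟨ toℕ-next (next^ t i) ⟩
  (1 + toℕ (next^ t i)) % suc m                        ≡⟨ cong (λ a → (1 + a) % suc m) (toℕ-next^ t i) ⟩
  (1 + (toℕ i + t) % suc m) % suc m                    ≡⟨ %-distribˡ-+ 1 _ (suc m) ⟩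
  (1 % suc m + (toℕ i + t) % suc m % suc m) % suc m    ≡⟨ cong (λ a → (1 % suc m + a) % suc m)
                                                              (m%n%n≡m%n (toℕ i + t) (suc m)) ⟩
  (1 % suc m + (toℕ i + t) % suc m) % suc m            ≡⟨ %-distribˡ-+ 1 (toℕ i + t) (suc m) ⟨
  (1 + (toℕ i + t)) % suc m                            ≡⟨ cong (_% suc m) (+-suc (toℕ i) t) ⟨
  (toℕ i + suc t) % suc m                              ∎
  where open ≡-Reasoning

next^-period : ∀ {m} (i : Fin (suc m)) → next^ (suc m) i ≡ i
next^-period {m} i = toℕ-injective (begin
  toℕ (next^ (suc m) i)      ≡⟨ toℕ-next^ (suc m) i ⟩
  (toℕ i + suc m) % suc m    ≡⟨ [m+n]%n≡m%n (toℕ i) (suc m) ⟩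
  toℕ i % suc m              ≡⟨ m<n⇒m%n≡m (toℕ<n i) ⟩
  toℕ i                      ∎)
  where open ≡-Reasoning

next^-next : ∀ {m} t (i : Fin (suc m)) → next^ t (next i) ≡ next (next^ t i)
next^-next zero    i = refl
next^-next (suc t) i = cong next (next^-next t i)

next-prev : ∀ {m} (i : Fin (suc m)) → next (prev i) ≡ i
next-prev = next^-period

prev-next : ∀ {m} (i : Fin (suc m)) → prev (next i) ≡ i
prev-next {m} i = trans (next^-next m i) (next^-period i)

next^-irrefl : ∀ {m} t (i : Fin (suc m)) → 0 < t → t < suc m → next^ t i ≢ i
next^-irrefl {m} t i 0<t t<N eq with toℕ i + t <? suc m
... | yes i+t<N = <⇒≢ (+-monoʳ-< (toℕ i) 0<t) (begin
  toℕ i + 0            ≡⟨ +-identityʳ (toℕ i) ⟩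
  toℕ i                ≡⟨ cong toℕ eq ⟨
  toℕ (next^ t i)      ≡⟨ toℕ-next^ t i ⟩
  (toℕ i + t) % suc m  ≡⟨ m<n⇒m%n≡m i+t<N ⟩
  toℕ i + t            ∎)
  where open ≡-Reasoning
... | no  i+t≮N = <⇒≢ t<N (+-cancelˡ-≡ (toℕ i) t (suc m) (begin
  toℕ i + t                     ≡⟨ m∸n+n≡m N≤i+t ⟨
  (toℕ i + t ∸ suc m) + suc m   ≡⟨ cong (_+ suc m) wrapped≡i ⟩
  toℕ i + suc m                 ∎))
  where
  open ≡-Reasoning
  N≤i+t : suc m ≤ toℕ i + t
  N≤i+t = ≮⇒≥ i+t≮N
  wrapped≡i : toℕ i + t ∸ suc m ≡ toℕ i
  wrapped≡i = begin
    toℕ i + t ∸ suc m              ≡⟨ m<n⇒m%n≡m (m<n+o⇒m∸n<o _ (suc m) (+-mono-< (toℕ<n i) t<N)) ⟨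
    (toℕ i + t ∸ suc m) % suc m    ≡⟨ m≤n⇒[n∸m]%m≡n%m N≤i+t ⟩
    (toℕ i + t) % suc m            ≡⟨ toℕ-next^ t i ⟨
    toℕ (next^ t i)                ≡⟨ cong toℕ eq ⟩
    toℕ i                          ∎

next^-reaches : ∀ {m} (i j : Fin (suc m)) → ∃ λ t → next^ t i ≡ j
next^-reaches {m} i j = t , toℕ-injective (begin
  toℕ (next^ t i)              ≡⟨ toℕ-next^ t i ⟩
  (toℕ i + t) % suc m          ≡⟨ cong (_% suc m) i+t≡j+N ⟩
  (toℕ j + suc m) % suc m      ≡⟨ [m+n]%n≡m%n (toℕ j) (suc m) ⟩
  toℕ j % suc m                ≡⟨ m<n⇒m%n≡m (toℕ<n j) ⟩
  toℕ j                        ∎)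
  where
  open ≡-Reasoning
  t : ℕ
  t = toℕ j + (suc m ∸ toℕ i)
  i+t≡j+N : toℕ i + t ≡ toℕ j + suc m
  i+t≡j+N = trans (+-comm (toℕ i) t)
              (trans (+-assoc (toℕ j) _ _) (cong (toℕ j +_) (m∸n+n≡m (<⇒≤ (toℕ<n i)))))

along-next⇒connected : ∀ {m} (G : Graph (suc m)) → (∀ v → adj G v (next v) ≡ true) → Connected G
along-next⇒connected G next-adjacent u v with next^-reaches u v
... | t , refl = walk t u
  where
  walk : ∀ t u → Reachable G u (next^ t u)
  walk zero    u = here
  walk (suc t) u = step (next-adjacent u) (subst (Reachable G (next u)) (next^-next t u) (walk t (next u)))

argmin : ∀ {m} (f : Fin (suc m) → ℕ) → ∃ λ i → ∀ j → f i ≤ f j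
argmin {zero}  f = zero , λ { zero → ≤-refl }
argmin {suc m} f with argmin (λ i → f (suc i))
... | i , min with f zero ≤? f (suc i)
...   | yes f₀≤ = zero , λ { zero → ≤-refl ; (suc j) → ≤-trans f₀≤ (min j) }
...   | no  f₀≰ = suc i , λ { zero → <⇒≤ (≰⇒> f₀≰) ; (suc j) → min j }

-- Neighbours on a cycle

module CycleNeighbours {V : Set} (E : V → V → Bool) (E-sym : ∀ u v → E u v ≡ E v u)
  {m : ℕ} (3≤N : 3 ≤ suc m) (W : Fin (suc m) → V) (W-injective : ∀ {i j} → W i ≡ W j → i ≡ j)
  (W-edges : ∀ i → E (W i) (W (next i)) ≡ true) where

  OnCycle : V → Set
  OnCycle v = ∃ λ i → W i ≡ v

  Consecutive : V → V → Set
  Consecutive u v = ∃ λ i → (W i ≡ u × W (next i) ≡ v) ⊎ (W i ≡ v × W (next i) ≡ u)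

  consecutive-sym : ∀ {u v} → Consecutive u v → Consecutive v u
  consecutive-sym (i , inj₁ (p , q)) = i , inj₂ (p , q)
  consecutive-sym (i , inj₂ (p , q)) = i , inj₁ (p , q)

  consecutive⇒edge : ∀ {u v} → Consecutive u v → E u v ≡ true
  consecutive⇒edge (i , inj₁ (refl , refl)) = W-edges i
  consecutive⇒edge (i , inj₂ (refl , refl)) = trans (E-sym _ _) (W-edges i)

  consecutive⇒onCycle : ∀ {u v} → Consecutive u v → OnCycle u
  consecutive⇒onCycle (i , inj₁ (p , _)) = i , p
  consecutive⇒onCycle (i , inj₂ (_ , q)) = next i , q

  consecutive⇒onCycleʳ : ∀ {u v} → Consecutive u v → OnCycle v
  consecutive⇒onCycleʳ = consecutive⇒onCycle ∘ consecutive-sym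

  consecutive-next : ∀ i → Consecutive (W i) (W (next i))
  consecutive-next i = i , inj₁ (refl , refl)

  consecutive-prev : ∀ i → Consecutive (W i) (W (prev i))
  consecutive-prev i = prev i , inj₂ (refl , cong W (next-prev i))

  consecutive-back : ∀ p {u} → W (next p) ≡ u → Consecutive u (W p)
  consecutive-back p refl = consecutive-sym (consecutive-next p)

  consecutive-forth : ∀ q {u} → W q ≡ u → Consecutive u (W (next q))
  consecutive-forth q refl = consecutive-next q

  consecutive-cases : ∀ {i u v} → W i ≡ u → Consecutive u v → v ≡ W (next i) ⊎ v ≡ W (prev i)
  consecutive-cases refl (j , inj₁ (p , q)) with W-injective p
  ... | refl = inj₁ (sym q)
  consecutive-cases refl (j , inj₂ (p , q)) with W-injective q
  ... | refl = inj₂ (trans (sym p) (cong W (sym (prev-next j))))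

  next≢prev : ∀ i → W (next i) ≢ W (prev i)
  next≢prev i eq =
    next^-irrefl 2 (prev i) (s≤s z≤n) 3≤N (trans (cong next (next-prev i)) (W-injective eq))

  no-two-cycle : ∀ p q → W p ≡ W (next q) → W (next p) ≡ W q → ⊥
  no-two-cycle p q e₁ e₂ =
    next^-irrefl 2 q (s≤s z≤n) 3≤N (trans (cong next (sym (W-injective e₁))) (W-injective e₂))

  cycle-neighbours : ∀ {v} → OnCycle v → ∃ λ u → ∃ λ w → u ≢ w × Consecutive v u × Consecutive v w
  cycle-neighbours (i , refl) = W (next i) , W (prev i) , next≢prev i , consecutive-next i , consecutive-prev i

  at-most-two-neighbours : ∀ {u a b w} → Consecutive u a → Consecutive u b → a ≢ b →
                           Consecutive u w → w ≡ a ⊎ w ≡ b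
  at-most-two-neighbours ua ub a≢b uw with consecutive⇒onCycle ua
  ... | i , Wi≡u with consecutive-cases Wi≡u ua | consecutive-cases Wi≡u ub | consecutive-cases Wi≡u uw
  ... | inj₁ a≡ | inj₁ b≡ | _       = ⊥-elim (a≢b (trans a≡ (sym b≡)))
  ... | inj₂ a≡ | inj₂ b≡ | _       = ⊥-elim (a≢b (trans a≡ (sym b≡)))
  ... | inj₁ a≡ | inj₂ _  | inj₁ w≡ = inj₁ (trans w≡ (sym a≡))
  ... | inj₁ _  | inj₂ b≡ | inj₂ w≡ = inj₂ (trans w≡ (sym b≡))
  ... | inj₂ _  | inj₁ b≡ | inj₁ w≡ = inj₂ (trans w≡ (sym b≡))
  ... | inj₂ a≡ | inj₁ _  | inj₂ w≡ = inj₁ (trans w≡ (sym a≡))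

  another-neighbour : ∀ {u a} → Consecutive u a → ∃ λ b → b ≢ a × Consecutive u b
  another-neighbour ua with consecutive⇒onCycle ua
  ... | i , refl with consecutive-cases refl ua
  ... | inj₁ a≡ = W (prev i) , (λ eq → next≢prev i (trans (sym a≡) (sym eq))) , consecutive-prev i
  ... | inj₂ a≡ = W (next i) , (λ eq → next≢prev i (trans eq a≡)) , consecutive-next i

  forced-neighbours : ∀ {u a b} → OnCycle u → (∀ v → E u v ≡ true → v ≡ a ⊎ v ≡ b) →
                      Consecutive u a × Consecutive u b
  forced-neighbours (i , refl) nbrs with nbrs _ (consecutive⇒edge (consecutive-next i))
                                      | nbrs _ (consecutive⇒edge (consecutive-prev i))
  ... | inj₁ n≡a | inj₂ p≡b = subst (Consecutive (W i)) n≡a (consecutive-next i)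
                            , subst (Consecutive (W i)) p≡b (consecutive-prev i)
  ... | inj₂ n≡b | inj₁ p≡a = subst (Consecutive (W i)) p≡a (consecutive-prev i)
                            , subst (Consecutive (W i)) n≡b (consecutive-next i)
  ... | inj₁ n≡a | inj₁ p≡a = ⊥-elim (next≢prev i (trans n≡a (sym p≡a)))
  ... | inj₂ n≡b | inj₂ p≡b = ⊥-elim (next≢prev i (trans n≡b (sym p≡b)))

  closed⇒everywhere : (Q : V → Set) → (∀ i → Q (W i) → Q (W (next i))) →
                      ∀ i → Q (W i) → ∀ j → Q (W j)
  closed⇒everywhere Q closed i Qi j with next^-reaches i j
  ... | t , refl = iterate t
    where
    iterate : ∀ t → Q (W (next^ t i))
    iterate zero    = Qi
    iterate (suc t) = closed (next^ t i) (iterate t)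

  exit-point : (Q : V → Set) → (∀ v → Dec (Q v)) → ∀ i j → Q (W i) → ¬ Q (W j) →
               ∃ λ p → Q (W p) × ¬ Q (W (next p))
  exit-point Q Q? i j Qi ¬Qj with next^-reaches i j
  ... | t , refl = search t ¬Qj
    where
    search : ∀ t → ¬ Q (W (next^ t i)) → ∃ λ p → Q (W p) × ¬ Q (W (next p))
    search zero    ¬Q = ⊥-elim (¬Q Qi)
    search (suc t) ¬Q with Q? (W (next^ t i))
    ... | yes Q₀  = next^ t i , Q₀ , ¬Q
    ... | no  ¬Q₀ = search t ¬Q₀

  entry-point : (Q : V → Set) → (∀ v → Dec (Q v)) → ∀ i j → Q (W i) → ¬ Q (W j) →
                ∃ λ q → ¬ Q (W q) × Q (W (next q))
  entry-point Q Q? i j Qi ¬Qj with exit-point (λ v → ¬ Q v) (λ v → ¬? (Q? v)) j i ¬Qj (λ ¬Q → ¬Q Qi)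
  ... | q , ¬Qq , ¬¬Qnext = q , ¬Qq , decidable-stable (Q? _) ¬¬Qnext

  Chordless : Set
  Chordless = ∀ i j → E (W i) (W j) ≡ true → j ≡ next i ⊎ i ≡ next j

  chordless⇒skip-nonadjacent : Chordless → 4 ≤ suc m → ∀ i → E (W i) (W (next (next i))) ≢ true
  chordless⇒skip-nonadjacent chordless 4≤N i chord with chordless i (next (next i)) chord
  ... | inj₁ eq = next^-irrefl 1 (next i) (s≤s z≤n) (≤-trans (s≤s (s≤s z≤n)) 3≤N) eq
  ... | inj₂ eq = next^-irrefl 3 i (s≤s z≤n) 4≤N (sym eq)

  chordless⇒neighbours-nonadjacent : Chordless → 4 ≤ suc m → ∀ i → E (W (prev i)) (W (next i)) ≢ true
  chordless⇒neighbours-nonadjacent chordless 4≤N i =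
    subst (λ j → E (W (prev i)) (W (next j)) ≢ true) (next-prev i)
      (chordless⇒skip-nonadjacent chordless 4≤N (prev i))

  upper-neighbours-unique⇒⊥ : (ρ : V → ℕ) (P : V → Set) → (∀ i → P (W i)) →
    (∀ v u w → P v → P u → P w → E v u ≡ true → E v w ≡ true → ρ v ≤ ρ u → ρ v ≤ ρ w → u ≡ w) →
    ⊥
  upper-neighbours-unique⇒⊥ ρ P all-P unique with argmin (λ i → ρ (W i))
  ... | i , min = next≢prev i
    (unique (W i) (W (next i)) (W (prev i)) (all-P i) (all-P (next i)) (all-P (prev i))
            (W-edges i) (consecutive⇒edge (consecutive-prev i)) (min (next i)) (min (prev i)))

-- The core

-- Core vertices are numbered in the order in which the Hamiltonian cycle of the final graph
-- visits them before it runs along the chain from β back to α.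
pattern α  = zero
pattern ε₀ = suc α
pattern κ₀ = suc ε₀
pattern σ  = suc κ₀
pattern ε₁ = suc σ
pattern δ  = suc ε₁
pattern ε₂ = suc δ
pattern κ₁ = suc ε₂
pattern ε₃ = suc κ₁
pattern υ₁ = suc ε₃
pattern υ₂ = suc υ₁
pattern ε₄ = suc υ₂
pattern κ₂ = suc ε₄
pattern ε₅ = suc κ₂
pattern β  = suc ε₅

Core : Set
Core = Fin 15

isEar : Core → Bool
isEar ε₀ = true
isEar ε₁ = true
isEar ε₂ = true
isEar ε₃ = true
isEar ε₄ = true
isEar ε₅ = true
isEar _  = false

isCone : Core → Bool
isCone κ₀ = true
isCone κ₁ = true
isCone κ₂ = true
isCone _  = false

onPath : Core → Bool
onPath a = not (isEar a ∨ isCone a)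

-- The path vertices υ₁ υ₂ α β σ δ form a path once the chain is inserted between α and β.
link : Core → Core → Bool
link ε₀ κ₀ = true
link ε₀ α  = true
link ε₁ σ  = true
link ε₁ δ  = true
link ε₂ δ  = true
link ε₂ κ₁ = true
link ε₃ κ₁ = true
link ε₃ υ₁ = true
link ε₄ υ₂ = true
link ε₄ κ₂ = true
link ε₅ κ₂ = true
link ε₅ β  = true
link υ₁ υ₂ = true
link υ₂ α  = true
link β  σ  = true
link σ  δ  = true
link κ₀ κ₁ = true
link κ₀ κ₂ = true
link κ₁ κ₂ = true
link κ₀ b  = onPath b
link κ₁ b  = onPath b
link κ₂ b  = onPath b
link _  _  = false

coreAdj : Core → Core → Bool
coreAdj a b = link a b ∨ link b a

-- Ranks rise from both ends of the path towards its peak at the far end of the chain, so every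
-- path vertex has at most one path neighbour of rank at least its own (ears and cones are
-- never compared, their rank 0 is a dummy).
coreRank : Core → ℕ
coreRank υ₁ = 1
coreRank υ₂ = 2
coreRank α  = 3
coreRank β  = 3
coreRank σ  = 2
coreRank δ  = 1
coreRank _  = 0

NeighboursWithin : Core → List Core → Set
NeighboursWithin a bs = ∀ b → coreAdj a b ≡ true → b ∈ bs

neighboursWithin? : ∀ a bs → Dec (NeighboursWithin a bs)
neighboursWithin? a bs = all? (λ b → (coreAdj a b ≟ᵇ true) →-dec (b ∈? bs))

coreCycleOrder : Vec Core 15
coreCycleOrder = ε₀ ∷ κ₀ ∷ υ₁ ∷ ε₃ ∷ κ₁ ∷ ε₂ ∷ δ ∷ ε₁ ∷ σ ∷ β ∷ ε₅ ∷ κ₂ ∷ ε₄ ∷ υ₂ ∷ α ∷ []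

coreCycle : Fin 15 → Core
coreCycle = lookup coreCycleOrder

-- The facts below are checked by exhaustive evaluation; they are abstract so that their
-- (large) proof terms are never unfolded when the lemmas are used.
abstract
  coreAdj-irrefl : ∀ a → coreAdj a a ≡ false
  coreAdj-irrefl = from-yes (all? λ a → coreAdj a a ≟ᵇ false)

  cones : ∀ a → isCone a ≡ true → a ∈ κ₀ ∷ κ₁ ∷ κ₂ ∷ []
  cones = from-yes (all? λ a → (isCone a ≟ᵇ true) →-dec (a ∈? κ₀ ∷ κ₁ ∷ κ₂ ∷ []))

  cones-off-path : ∀ a → isCone a ≡ true → onPath a ≡ false
  cones-off-path = from-yes (all? λ a → (isCone a ≟ᵇ true) →-dec (onPath a ≟ᵇ false))

  σ-neighbours : NeighboursWithin σ (κ₀ ∷ ε₁ ∷ δ ∷ κ₁ ∷ κ₂ ∷ β ∷ [])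
  σ-neighbours = from-yes (neighboursWithin? σ (κ₀ ∷ ε₁ ∷ δ ∷ κ₁ ∷ κ₂ ∷ β ∷ []))

  core-ears-simplicial : ∀ e a b → isEar e ≡ true → coreAdj e a ≡ true → coreAdj e b ≡ true → a ≢ b →
                         coreAdj a b ≡ true
  core-ears-simplicial = from-yes (all? λ e → all? λ a → all? λ b →
    (isEar e ≟ᵇ true) →-dec ((coreAdj e a ≟ᵇ true) →-dec ((coreAdj e b ≟ᵇ true) →-dec
    (¬? (a ≟ b) →-dec (coreAdj a b ≟ᵇ true)))))

  core-cones-adjacent-to-non-ears : ∀ a b → isCone a ≡ true → isEar b ≡ false → a ≢ b → coreAdj a b ≡ true
  core-cones-adjacent-to-non-ears = from-yes (all? λ a → all? λ b →
    (isCone a ≟ᵇ true) →-dec ((isEar b ≟ᵇ false) →-dec (¬? (a ≟ b) →-dec (coreAdj a b ≟ᵇ true))))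

  core-upper-neighbour-unique : ∀ a b c → onPath a ≡ true → onPath b ≡ true → onPath c ≡ true →
    coreAdj a b ≡ true → coreAdj a c ≡ true → coreRank a ≤ coreRank b → coreRank a ≤ coreRank c → b ≡ c
  core-upper-neighbour-unique = from-yes (all? λ a → all? λ b → all? λ c →
    (onPath a ≟ᵇ true) →-dec ((onPath b ≟ᵇ true) →-dec ((onPath c ≟ᵇ true) →-dec
    ((coreAdj a b ≟ᵇ true) →-dec ((coreAdj a c ≟ᵇ true) →-dec
    ((coreRank a ≤? coreRank b) →-dec ((coreRank a ≤? coreRank c) →-dec (b ≟ c))))))))

  chain-ends-are-peaks : ∀ a b → a ∈ α ∷ β ∷ [] → onPath b ≡ true → coreAdj a b ≡ true → coreRank b < 3
  chain-ends-are-peaks = from-yes (all? λ a → all? λ b →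
    (a ∈? α ∷ β ∷ []) →-dec ((onPath b ≟ᵇ true) →-dec
    ((coreAdj a b ≟ᵇ true) →-dec (suc (coreRank b) ≤? 3))))

  coreCycle-injective : ∀ i j → coreCycle i ≡ coreCycle j → i ≡ j
  coreCycle-injective = from-yes (all? λ i → all? λ j → (coreCycle i ≟ coreCycle j) →-dec (i ≟ j))

  coreCycle-surjective : ∀ a → ∃ λ i → coreCycle i ≡ a
  coreCycle-surjective = from-yes (all? λ a → any? λ i → coreCycle i ≟ a)

  coreCycle-edges : ∀ i → coreAdj (coreCycle i) (coreCycle (next i)) ≡ true
  coreCycle-edges = from-yes (all? λ i → coreAdj (coreCycle i) (coreCycle (next i)) ≟ᵇ true)

pattern core  a = inj₁ a
pattern chain j = inj₂ j

≡ᵇ-refl : ∀ m → (m ≡ᵇ m) ≡ true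
≡ᵇ-refl zero    = refl
≡ᵇ-refl (suc m) = ≡ᵇ-refl m

1+n≡ᵇn : ∀ n → (suc n ≡ᵇ n) ≡ false
1+n≡ᵇn zero    = refl
1+n≡ᵇn (suc n) = 1+n≡ᵇn n

splitAt-injective : ∀ m {n} {u v : Fin (m + n)} → splitAt m u ≡ splitAt m v → u ≡ v
splitAt-injective m {n} {u} {v} eq =
  trans (sym (join-splitAt m n u)) (trans (cong (join m n) eq) (join-splitAt m n v))

-- The graph

module Construction (k : ℕ) where

  Vertex : Set
  Vertex = Core ⊎ Fin (suc k)

  coreChain : Core → Fin (suc k) → Bool
  coreChain κ₀ _ = true
  coreChain κ₁ _ = true
  coreChain κ₂ _ = true
  coreChain α  j = toℕ j ≡ᵇ k
  coreChain β  j = toℕ j ≡ᵇ 0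
  coreChain _  _ = false

  adjV : Vertex → Vertex → Bool
  adjV (core a)  (core b)  = coreAdj a b
  adjV (core a)  (chain j) = coreChain a j
  adjV (chain j) (core a)  = coreChain a j
  adjV (chain i) (chain j) = (suc (toℕ i) ≡ᵇ toℕ j) ∨ (suc (toℕ j) ≡ᵇ toℕ i)

  adjV-sym : ∀ u v → adjV u v ≡ adjV v u
  adjV-sym (core a)  (core b)  = ∨-comm (link a b) (link b a)
  adjV-sym (core a)  (chain j) = refl
  adjV-sym (chain j) (core a)  = refl
  adjV-sym (chain i) (chain j) = ∨-comm (suc (toℕ i) ≡ᵇ toℕ j) (suc (toℕ j) ≡ᵇ toℕ i)

  adjV-irrefl : ∀ v → adjV v v ≡ false
  adjV-irrefl (core a)  = coreAdj-irrefl a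
  adjV-irrefl (chain j) rewrite 1+n≡ᵇn (toℕ j) = refl

  n : ℕ
  n = 15 + suc k

  G : Graph n
  G = record
    { adj    = λ u v → adjV (splitAt 15 u) (splitAt 15 v)
    ; sym    = λ u v → adjV-sym (splitAt 15 u) (splitAt 15 v)
    ; irrefl = λ v → adjV-irrefl (splitAt 15 v)
    }

  chainAttached : List Core
  chainAttached = κ₀ ∷ κ₁ ∷ κ₂ ∷ α ∷ β ∷ []

  abstract
    detached : ∀ j a → a ∉ chainAttached → coreChain a j ≡ false
    detached j = from-yes (all? λ a → ¬? (a ∈? chainAttached) →-dec (coreChain a j ≟ᵇ false))

    ears-detached : ∀ j e → isEar e ≡ true → coreChain e j ≡ false
    ears-detached j = from-yes (all? λ e → (isEar e ≟ᵇ true) →-dec (coreChain e j ≟ᵇ false))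

    cones-attached : ∀ j a → isCone a ≡ true → coreChain a j ≡ true
    cones-attached j = from-yes (all? λ a → (isCone a ≟ᵇ true) →-dec (coreChain a j ≟ᵇ true))

  core-chain-adjacency : ∀ a j → coreChain a j ≡ true →
    isCone a ≡ true ⊎ (a ≡ α × toℕ j ≡ k) ⊎ (a ≡ β × toℕ j ≡ 0)
  core-chain-adjacency a j adj with a ∈? chainAttached
  ... | no  a∉ = contradiction (trans (sym adj) (detached j a a∉)) λ ()
  ... | yes (here refl)                                 = inj₁ refl
  ... | yes (there (here refl))                         = inj₁ refl
  ... | yes (there (there (here refl)))                 = inj₁ refl
  ... | yes (there (there (there (here refl))))         =
    inj₂ (inj₁ (refl , ≡ᵇ⇒≡ (toℕ j) k (subst T (sym adj) _)))
  ... | yes (there (there (there (there (here refl))))) =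
    inj₂ (inj₂ (refl , ≡ᵇ⇒≡ (toℕ j) 0 (subst T (sym adj) _)))

  chain-adjacency : ∀ i j → adjV (chain i) (chain j) ≡ true → toℕ j ≡ suc (toℕ i) ⊎ toℕ i ≡ suc (toℕ j)
  chain-adjacency i j adj with suc (toℕ i) ≡ᵇ toℕ j in up | suc (toℕ j) ≡ᵇ toℕ i in down
  ... | true  | _     = inj₁ (sym (≡ᵇ⇒≡ (suc (toℕ i)) (toℕ j) (subst T (sym up) _)))
  ... | false | true  = inj₂ (sym (≡ᵇ⇒≡ (suc (toℕ j)) (toℕ i) (subst T (sym down) _)))
  ... | false | false = contradiction adj λ ()

  module LabelledCycle (C : Cycle G) where

    W : Fin (suc (Cycle.m C)) → Vertex
    W i = splitAt 15 (vtx C i)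

    W-injective : ∀ {i j} → W i ≡ W j → i ≡ j
    W-injective eq = inj C (splitAt-injective 15 eq)

    open CycleNeighbours adjV adjV-sym (len≥3 C) W W-injective (edges C) public

    onCycle? : ∀ v → Dec (OnCycle v)
    onCycle? v = any? λ i → ≡-dec _≟_ _≟_ (W i) v

    avoiding-chain⇒size≤15 : (∀ j → ¬ OnCycle (chain j)) → size C ≤ 15
    avoiding-chain⇒size≤15 no-chain = injective⇒≤ label-injective
      where
      core-label : ∀ i → ∃ λ a → W i ≡ core a
      core-label i with W i in Wi≡
      ... | core a  = a , refl
      ... | chain j = ⊥-elim (no-chain j (i , Wi≡))

      label-injective : ∀ {i j} → proj₁ (core-label i) ≡ proj₁ (core-label j) → i ≡ j
      label-injective {i} {j} eq =
        W-injective (trans (proj₂ (core-label i)) (trans (cong core eq) (sym (proj₂ (core-label j)))))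

    spanning⇒n≤size : (∀ v → OnCycle v) → n ≤ size C
    spanning⇒n≤size on = injective⇒≤ position-injective
      where
      position-injective : ∀ {u v} → proj₁ (on (splitAt 15 u)) ≡ proj₁ (on (splitAt 15 v)) → u ≡ v
      position-injective {u} {v} eq =
        splitAt-injective 15 (trans (sym (proj₂ (on _))) (trans (cong W eq) (proj₂ (on _))))

  NonEar : Vertex → Set
  NonEar (core a)  = isEar a ≡ false
  NonEar (chain _) = ⊤

  NonCone : Vertex → Set
  NonCone (core a)  = isCone a ≡ false
  NonCone (chain _) = ⊤

  OnPath : Vertex → Set
  OnPath (core a)  = onPath a ≡ true
  OnPath (chain _) = ⊤

  pathRank : Vertex → ℕ
  pathRank (core a)  = coreRank a
  pathRank (chain j) = 4 + toℕ j

  ears-simplicial : ∀ e u w → isEar e ≡ true → adjV (core e) u ≡ true → adjV (core e) w ≡ true →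
                    u ≢ w → adjV u w ≡ true
  ears-simplicial e (core a)  (core b)  ear eu ew u≢w = core-ears-simplicial e a b ear eu ew (u≢w ∘ cong core)
  ears-simplicial e (chain j) w         ear eu _  _   = contradiction (trans (sym eu) (ears-detached j e ear)) λ ()
  ears-simplicial e (core a)  (chain j) ear _  ew _   = contradiction (trans (sym ew) (ears-detached j e ear)) λ ()

  cones-adjacent-to-non-ears : ∀ a v → isCone a ≡ true → NonEar v → v ≢ core a → adjV (core a) v ≡ true
  cones-adjacent-to-non-ears a (core b)  cone ¬ear v≢a =
    core-cones-adjacent-to-non-ears a b cone ¬ear (λ a≡b → v≢a (cong core (sym a≡b)))
  cones-adjacent-to-non-ears a (chain j) cone _ _ = cones-attached j a cone

  chain-end-neighbour : ∀ a j → onPath a ≡ true → coreChain a j ≡ true →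
                        (a ≡ α × toℕ j ≡ k) ⊎ (a ≡ β × toℕ j ≡ 0)
  chain-end-neighbour a j path adj with core-chain-adjacency a j adj
  ... | inj₁ cone = contradiction (trans (sym path) (cones-off-path a cone)) λ ()
  ... | inj₂ end  = end

  chain-end-above-core : ∀ a b j → onPath a ≡ true → onPath b ≡ true → coreChain a j ≡ true →
                         coreAdj a b ≡ true → coreRank b < coreRank a
  chain-end-above-core a b j path-a path-b aj ab with chain-end-neighbour a j path-a aj
  ... | inj₁ (refl , _) = chain-ends-are-peaks α b (here refl) path-b ab
  ... | inj₂ (refl , _) = chain-ends-are-peaks β b (there (here refl)) path-b ab

  chain-above-core : ∀ a j → onPath a ≡ true → coreChain a j ≡ true → coreRank a < pathRank (chain j)
  chain-above-core a j path adj with chain-end-neighbour a j path adj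
  ... | inj₁ (refl , _) = s≤s (s≤s (s≤s (s≤s z≤n)))
  ... | inj₂ (refl , _) = s≤s (s≤s (s≤s (s≤s z≤n)))

  chain-upper-neighbour : ∀ j i → adjV (chain j) (chain i) ≡ true → toℕ j ≤ toℕ i → toℕ i ≡ suc (toℕ j)
  chain-upper-neighbour j i adj j≤i with chain-adjacency j i adj
  ... | inj₁ above = above
  ... | inj₂ below = contradiction (subst (_≤ toℕ i) below j≤i) 1+n≰n

  path-upper-neighbour-unique : ∀ v u w → OnPath v → OnPath u → OnPath w →
    adjV v u ≡ true → adjV v w ≡ true → pathRank v ≤ pathRank u → pathRank v ≤ pathRank w → u ≡ w
  path-upper-neighbour-unique (core a) (core b) (core c) pa pb pc ab ac ≤b ≤c =
    cong core (core-upper-neighbour-unique a b c pa pb pc ab ac ≤b ≤c)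
  path-upper-neighbour-unique (core a) (core b) (chain j) pa pb _ ab aj ≤b _ =
    contradiction ≤b (<⇒≱ (chain-end-above-core a b j pa pb aj ab))
  path-upper-neighbour-unique (core a) (chain j) (core c) pa _ pc aj ac _ ≤c =
    contradiction ≤c (<⇒≱ (chain-end-above-core a c j pa pc aj ac))
  path-upper-neighbour-unique (core a) (chain i) (chain j) pa _ _ ai aj _ _
    with chain-end-neighbour a i pa ai | chain-end-neighbour a j pa aj
  ... | inj₁ (refl , i≡k) | inj₁ (_ , j≡k) = cong chain (toℕ-injective (trans i≡k (sym j≡k)))
  ... | inj₂ (refl , i≡0) | inj₂ (_ , j≡0) = cong chain (toℕ-injective (trans i≡0 (sym j≡0)))
  ... | inj₁ (refl , _)   | inj₂ (() , _)
  ... | inj₂ (refl , _)   | inj₁ (() , _)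
  path-upper-neighbour-unique (chain j) (core b) _ _ pb _ jb _ ≤b _ =
    contradiction ≤b (<⇒≱ (≤-trans (chain-above-core b j pb jb) (m≤n+m _ 0)))
  path-upper-neighbour-unique (chain j) (chain i) (core c) _ _ pc _ jc _ ≤c =
    contradiction ≤c (<⇒≱ (≤-trans (chain-above-core c j pc jc) (m≤n+m _ 0)))
  path-upper-neighbour-unique (chain j) (chain i) (chain i′) _ _ _ ji ji′ ≤i ≤i′ =
    cong chain (toℕ-injective (trans (chain-upper-neighbour j i ji (+-cancelˡ-≤ 4 _ _ ≤i))
                                     (sym (chain-upper-neighbour j i′ ji′ (+-cancelˡ-≤ 4 _ _ ≤i′)))))

  -- An induced cycle of length at least 4 avoids the ears (whose neighbours are adjacent) and
  -- then the cones (adjacent to the vertex two steps further on), and the path has no cycle.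
  chordal : Chordal G
  chordal C 4≤N chordless = upper-neighbours-unique⇒⊥ pathRank OnPath on-path path-upper-neighbour-unique
    where
    open LabelledCycle C

    ear-free : ∀ i → NonEar (W i)
    ear-free i with W i in Wi≡
    ... | chain _ = _
    ... | core e with isEar e in ear
    ...   | false = refl
    ...   | true  = ⊥-elim (chordless⇒neighbours-nonadjacent chordless 4≤N i
      (ears-simplicial e _ _ ear
        (consecutive⇒edge (subst (λ v → Consecutive v (W (prev i))) Wi≡ (consecutive-prev i)))
        (consecutive⇒edge (consecutive-forth i Wi≡))
        (next≢prev i ∘ sym)))

    cone-free : ∀ i → NonCone (W i)
    cone-free i with W i in Wi≡
    ... | chain _ = _
    ... | core a with isCone a in cone
    ...   | false = refl
    ...   | true  = ⊥-elim (chordless⇒skip-nonadjacent chordless 4≤N i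
      (subst (λ v → adjV v (W (next (next i))) ≡ true) (sym Wi≡)
        (cones-adjacent-to-non-ears a _ cone (ear-free (next (next i)))
          (λ eq → next^-irrefl 2 i (s≤s z≤n) (len≥3 C) (W-injective (trans eq (sym Wi≡)))))))

    on-path : ∀ i → OnPath (W i)
    on-path i with W i | ear-free i | cone-free i
    ... | chain _ | _    | _     = _
    ... | core a  | ¬ear | ¬cone = cong₂ (λ e c → not (e ∨ c)) ¬ear ¬cone

  abstract
    core-steps : ∀ (a : Core) → adj G (a ↑ˡ suc k) (next (a ↑ˡ suc k)) ≡ true
    core-steps = from-yes (all? λ (a : Core) → adj G (a ↑ˡ suc k) (next (a ↑ˡ suc k)) ≟ᵇ true)

  next-chain : ∀ {j j′ : Fin (suc k)} → toℕ j′ ≡ suc (toℕ j) → next (15 ↑ʳ j) ≡ 15 ↑ʳ j′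
  next-chain {j} {j′} j′≡ =
    toℕ-injective (trans (toℕ-next-< (15 ↑ʳ j) (subst (_< n) (sym shift) (toℕ<n (15 ↑ʳ j′)))) shift)
    where
    shift : suc (toℕ (15 ↑ʳ j)) ≡ toℕ (15 ↑ʳ j′)
    shift = trans (cong suc (toℕ-↑ʳ 15 j)) (trans (cong (15 +_) (sym j′≡)) (sym (toℕ-↑ʳ 15 j′)))

  chain-consecutive-adjacent : ∀ {j j′} → toℕ j′ ≡ suc (toℕ j) → adjV (chain j) (chain j′) ≡ true
  chain-consecutive-adjacent {j} j′≡ rewrite j′≡ | ≡ᵇ-refl (toℕ j) = refl

  chain-steps : ∀ j → adjV (chain j) (splitAt 15 (next (15 ↑ʳ j))) ≡ true
  chain-steps j with suc (toℕ j) <? suc k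
  ... | yes j<k = subst (λ v → adjV (chain j) v ≡ true)
                    (sym (trans (cong (splitAt 15) (next-chain (toℕ-fromℕ< j<k))) (splitAt-↑ʳ 15 (suc k) _)))
                    (chain-consecutive-adjacent (toℕ-fromℕ< j<k))
  ... | no  j≮k = subst (λ v → adjV (chain j) v ≡ true)
                    (sym (cong (splitAt 15) (next-last (15 ↑ʳ j) (trans (toℕ-↑ʳ 15 j) (cong (15 +_) j≡k)))))
                    (subst (λ t → (t ≡ᵇ k) ≡ true) (sym j≡k) (≡ᵇ-refl k))
    where
    j≡k : toℕ j ≡ k
    j≡k = suc-injective (≤-antisym (toℕ<n j) (≮⇒≥ j≮k))

  consecutive-indices-adjacent : ∀ v → adj G v (next v) ≡ true
  consecutive-indices-adjacent v =
    subst (λ u → adj G u (next u) ≡ true) (join-splitAt 15 (suc k) v) (from-split (splitAt 15 v))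
    where
    from-split : ∀ s → adj G (join 15 (suc k) s) (next (join 15 (suc k) s)) ≡ true
    from-split (core a)  = core-steps a
    from-split (chain j) = subst (λ u → adjV u (splitAt 15 (next (15 ↑ʳ j))) ≡ true)
                             (sym (splitAt-↑ʳ 15 (suc k) j)) (chain-steps j)

  hamiltonian-cycle : Cycle G
  hamiltonian-cycle = record
    { m = 14 + suc k ; len≥3 = s≤s (s≤s (s≤s z≤n)) ; vtx = id ; inj = id
    ; edges = consecutive-indices-adjacent }

  core-cycle : Cycle G
  core-cycle = record
    { m = 14 ; len≥3 = s≤s (s≤s (s≤s z≤n)) ; vtx = λ i → coreCycle i ↑ˡ suc k
    ; inj = λ eq → coreCycle-injective _ _ (↑ˡ-injective (suc k) _ _ eq)
    ; edges = λ i → subst₂ (λ u v → adjV u v ≡ true) (sym (splitAt-↑ˡ 15 (coreCycle i) (suc k)))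
                      (sym (splitAt-↑ˡ 15 (coreCycle (next i)) (suc k))) (coreCycle-edges i) }

  -- Cycles through the whole core

  IsChain : Vertex → Set
  IsChain (core _)  = ⊥
  IsChain (chain _) = ⊤

  isChain? : ∀ v → Dec (IsChain v)
  isChain? (core _)  = no λ ()
  isChain? (chain _) = yes _

  chain≢core : ∀ {v a} → IsChain v → v ≢ core a
  chain≢core is-chain refl = is-chain

  module CoreCovered (C : Cycle G) (core-on-C : ∀ a → LabelledCycle.OnCycle C (core a)) where
    open LabelledCycle C

    ear-forced : ∀ {e a b} → isEar e ≡ true → True (neighboursWithin? e (a ∷ b ∷ [])) →
                 Consecutive (core e) (core a) × Consecutive (core e) (core b)
    ear-forced {e} {a} {b} ear within = forced-neighbours (core-on-C e) neighbour
      where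
      neighbour : ∀ v → adjV (core e) v ≡ true → v ≡ core a ⊎ v ≡ core b
      neighbour (core c)  adj with toWitness within c adj
      ... | here refl         = inj₁ refl
      ... | there (here refl) = inj₂ refl
      neighbour (chain j) adj = contradiction (trans (sym adj) (ears-detached j e ear)) λ ()

    ε₀-forced : Consecutive (core ε₀) (core κ₀) × Consecutive (core ε₀) (core α)
    ε₀-forced = ear-forced refl _

    ε₁-forced : Consecutive (core ε₁) (core σ) × Consecutive (core ε₁) (core δ)
    ε₁-forced = ear-forced refl _

    ε₂-forced : Consecutive (core ε₂) (core δ) × Consecutive (core ε₂) (core κ₁)
    ε₂-forced = ear-forced refl _

    ε₃-forced : Consecutive (core ε₃) (core κ₁) × Consecutive (core ε₃) (core υ₁)
    ε₃-forced = ear-forced refl _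

    ε₄-forced : Consecutive (core ε₄) (core υ₂) × Consecutive (core ε₄) (core κ₂)
    ε₄-forced = ear-forced refl _

    ε₅-forced : Consecutive (core ε₅) (core κ₂) × Consecutive (core ε₅) (core β)
    ε₅-forced = ear-forced refl _

    δ-saturated : ∀ {w} → Consecutive (core δ) w → w ≡ core ε₁ ⊎ w ≡ core ε₂
    δ-saturated =
      at-most-two-neighbours (consecutive-sym (proj₂ ε₁-forced)) (consecutive-sym (proj₁ ε₂-forced)) λ ()

    κ₁-saturated : ∀ {w} → Consecutive (core κ₁) w → w ≡ core ε₂ ⊎ w ≡ core ε₃
    κ₁-saturated =
      at-most-two-neighbours (consecutive-sym (proj₂ ε₂-forced)) (consecutive-sym (proj₁ ε₃-forced)) λ ()

    κ₂-saturated : ∀ {w} → Consecutive (core κ₂) w → w ≡ core ε₄ ⊎ w ≡ core ε₅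
    κ₂-saturated =
      at-most-two-neighbours (consecutive-sym (proj₂ ε₄-forced)) (consecutive-sym (proj₁ ε₅-forced)) λ ()

    σ-switch : Consecutive (core σ) (core β) ⊎ Consecutive (core σ) (core κ₀)
    σ-switch with another-neighbour (consecutive-sym (proj₁ ε₁-forced))
    ... | chain j , _ , σj = contradiction (consecutive⇒edge σj) λ ()
    ... | core b , b≢ε₁ , σb with σ-neighbours b (consecutive⇒edge σb)
    ... | here refl                                         = inj₂ σb
    ... | there (here refl)                                 = ⊥-elim (b≢ε₁ refl)
    ... | there (there (here refl))                         =
      [ (λ ()) , (λ ()) ]′ (δ-saturated (consecutive-sym σb))
    ... | there (there (there (here refl)))                 =
      [ (λ ()) , (λ ()) ]′ (κ₁-saturated (consecutive-sym σb))
    ... | there (there (there (there (here refl))))         =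
      [ (λ ()) , (λ ()) ]′ (κ₂-saturated (consecutive-sym σb))
    ... | there (there (there (there (there (here refl))))) = inj₁ σb

    data ChainNeighbour (a : Fin (suc k)) : Vertex → Set where
      via-κ₀ : ChainNeighbour a (core κ₀)
      via-α  : toℕ a ≡ k → ChainNeighbour a (core α)
      via-β  : toℕ a ≡ 0 → ChainNeighbour a (core β)
      above  : ∀ j → toℕ j ≡ suc (toℕ a) → ChainNeighbour a (chain j)
      below  : ∀ j → toℕ a ≡ suc (toℕ j) → ChainNeighbour a (chain j)

    chain-neighbour : ∀ {a v} → Consecutive (chain a) v → ChainNeighbour a v
    chain-neighbour {a} {core b} av with core-chain-adjacency b a (consecutive⇒edge av)
    ... | inj₂ (inj₁ (refl , a≡k)) = via-α a≡k
    ... | inj₂ (inj₂ (refl , a≡0)) = via-β a≡0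
    ... | inj₁ cone with cones b cone
    ...   | here refl                 = via-κ₀
    ...   | there (here refl)         = [ (λ ()) , (λ ()) ]′ (κ₁-saturated (consecutive-sym av))
    ...   | there (there (here refl)) = [ (λ ()) , (λ ()) ]′ (κ₂-saturated (consecutive-sym av))
    chain-neighbour {a} {chain j} av with chain-adjacency a j (consecutive⇒edge av)
    ... | inj₁ up   = above j up
    ... | inj₂ down = below j down

    module SwitchAtCone (σκ₀ : Consecutive (core σ) (core κ₀)) where

      κ₀-saturated : ∀ {w} → Consecutive (core κ₀) w → w ≡ core ε₀ ⊎ w ≡ core σ
      κ₀-saturated = at-most-two-neighbours (consecutive-sym (proj₁ ε₀-forced)) (consecutive-sym σκ₀) λ ()

      chain-avoids-κ₀ : ∀ {a} → ¬ Consecutive (chain a) (core κ₀)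
      chain-avoids-κ₀ aκ₀ = [ (λ ()) , (λ ()) ]′ (κ₀-saturated (consecutive-sym aκ₀))

      step-up : ∀ {a} → OnCycle (chain a) → toℕ a < k → ∃ λ j → toℕ j ≡ suc (toℕ a) × OnCycle (chain j)
      step-up on a<k with cycle-neighbours on
      ... | u , w , u≢w , au , aw with chain-neighbour au | chain-neighbour aw
      ... | above j e  | _           = j , e , consecutive⇒onCycleʳ au
      ... | _          | above j e   = j , e , consecutive⇒onCycleʳ aw
      ... | via-κ₀     | _           = ⊥-elim (chain-avoids-κ₀ au)
      ... | _          | via-κ₀      = ⊥-elim (chain-avoids-κ₀ aw)
      ... | via-α a≡k  | _           = contradiction a≡k (<⇒≢ a<k)
      ... | _          | via-α a≡k   = contradiction a≡k (<⇒≢ a<k)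
      ... | via-β _    | via-β _     = ⊥-elim (u≢w refl)
      ... | below j e  | below j′ e′ =
        ⊥-elim (u≢w (cong chain (toℕ-injective (suc-injective (trans (sym e) e′)))))
      ... | via-β a≡0  | below _ e   = contradiction (trans (sym a≡0) e) λ ()
      ... | below _ e  | via-β a≡0   = contradiction (trans (sym a≡0) e) λ ()

      step-down : ∀ {a d} → OnCycle (chain a) → toℕ a ≡ suc d → ∃ λ j → toℕ j ≡ d × OnCycle (chain j)
      step-down on a≡1+d with cycle-neighbours on
      ... | u , w , u≢w , au , aw with chain-neighbour au | chain-neighbour aw
      ... | below j e  | _           = j , suc-injective (trans (sym e) a≡1+d) , consecutive⇒onCycleʳ au
      ... | _          | below j e   = j , suc-injective (trans (sym e) a≡1+d) , consecutive⇒onCycleʳ aw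
      ... | via-κ₀     | _           = ⊥-elim (chain-avoids-κ₀ au)
      ... | _          | via-κ₀      = ⊥-elim (chain-avoids-κ₀ aw)
      ... | via-β a≡0  | _           = contradiction (trans (sym a≡0) a≡1+d) λ ()
      ... | _          | via-β a≡0   = contradiction (trans (sym a≡0) a≡1+d) λ ()
      ... | via-α _    | via-α _     = ⊥-elim (u≢w refl)
      ... | above j e  | above j′ e′ = ⊥-elim (u≢w (cong chain (toℕ-injective (trans e (sym e′)))))
      ... | via-α a≡k  | above j e   = ⊥-elim (<⇒≢ (toℕ<n j) (trans e (cong suc a≡k)))
      ... | above j e  | via-α a≡k   = ⊥-elim (<⇒≢ (toℕ<n j) (trans e (cong suc a≡k)))

      reaches-start : ∀ d {a} → toℕ a ≡ d → OnCycle (chain a) → ∃ λ j → toℕ j ≡ 0 × OnCycle (chain j)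
      reaches-start zero    a≡0 on = _ , a≡0 , on
      reaches-start (suc d) a≡  on with step-down on a≡
      ... | j , j≡d , on-j = reaches-start d j≡d on-j

      reaches-up-to : ∀ t → t ≤ k → (∃ λ j → toℕ j ≡ 0 × OnCycle (chain j)) →
                      ∃ λ j → toℕ j ≡ t × OnCycle (chain j)
      reaches-up-to zero    _   start = start
      reaches-up-to (suc t) t<k start with reaches-up-to t (<⇒≤ t<k) start
      ... | j , j≡t , on-j with step-up on-j (subst (_< k) (sym j≡t) t<k)
      ...   | j′ , j′≡ , on-j′ = j′ , trans j′≡ (cong suc j≡t) , on-j′

      whole-chain : ∀ {a} → OnCycle (chain a) → ∀ j → OnCycle (chain j)
      whole-chain on j with reaches-up-to (toℕ j) (≤-pred (toℕ<n j)) (reaches-start _ refl on)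
      ... | j′ , j′≡j , on-j′ = subst (OnCycle ∘ chain) (toℕ-injective j′≡j) on-j′

    module SwitchAtEnd (σβ : Consecutive (core σ) (core β)) where

      β-saturated : ∀ {w} → Consecutive (core β) w → w ≡ core ε₅ ⊎ w ≡ core σ
      β-saturated = at-most-two-neighbours (consecutive-sym (proj₂ ε₅-forced)) (consecutive-sym σβ) λ ()

      Gate : Vertex → Set
      Gate v = v ≡ core κ₀ ⊎ v ≡ core α

      gate-ε₀ : ∀ {v} → Gate v → Consecutive v (core ε₀)
      gate-ε₀ (inj₁ refl) = consecutive-sym (proj₁ ε₀-forced)
      gate-ε₀ (inj₂ refl) = consecutive-sym (proj₂ ε₀-forced)

      leaves-chain-through-gate : ∀ {v w} → IsChain v → ¬ IsChain w → Consecutive v w → Gate w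
      leaves-chain-through-gate {chain _} _ ¬chain vw with chain-neighbour vw
      ... | via-κ₀    = inj₁ refl
      ... | via-α _   = inj₂ refl
      ... | via-β _   = [ (λ ()) , (λ ()) ]′ (β-saturated (consecutive-sym vw))
      ... | above _ _ = ⊥-elim (¬chain _)
      ... | below _ _ = ⊥-elim (¬chain _)

      gate-used-once : ∀ p q → IsChain (W p) → IsChain (W (next q)) → Gate (W (next p)) →
                       W (next p) ≡ W q → ⊥
      gate-used-once p q chain-p chain-nq gate eq
        with at-most-two-neighbours (gate-ε₀ gate) (consecutive-back p refl) (chain≢core chain-p ∘ sym)
                                    (consecutive-forth q (sym eq))
      ... | inj₁ nq≡ε₀ = chain≢core chain-nq nq≡ε₀
      ... | inj₂ nq≡p  = no-two-cycle p q (sym nq≡p) eq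

      Region : Vertex → Set
      Region v = IsChain v ⊎ Gate v ⊎ v ≡ core ε₀

      σ-outside : ¬ Region (core σ)
      σ-outside (inj₁ ())
      σ-outside (inj₂ (inj₁ (inj₁ ())))
      σ-outside (inj₂ (inj₁ (inj₂ ())))
      σ-outside (inj₂ (inj₂ ()))

      region-closed : ∀ {x y} → IsChain x → IsChain y → Consecutive (core κ₀) x → Consecutive (core α) y →
                      ∀ {v w} → Region v → Consecutive v w → Region w
      region-closed _ _ _ _ {v} {w} (inj₁ chain-v) vw with isChain? w
      ... | yes chain-w = inj₁ chain-w
      ... | no ¬chain-w = inj₂ (inj₁ (leaves-chain-through-gate chain-v ¬chain-w vw))
      region-closed cx _ κ₀x _ (inj₂ (inj₁ (inj₁ refl))) vw
        with at-most-two-neighbours (gate-ε₀ (inj₁ refl)) κ₀x (chain≢core cx ∘ sym) vw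
      ... | inj₁ refl = inj₂ (inj₂ refl)
      ... | inj₂ refl = inj₁ cx
      region-closed _ cy _ αy (inj₂ (inj₁ (inj₂ refl))) vw
        with at-most-two-neighbours (gate-ε₀ (inj₂ refl)) αy (chain≢core cy ∘ sym) vw
      ... | inj₁ refl = inj₂ (inj₂ refl)
      ... | inj₂ refl = inj₁ cy
      region-closed _ _ _ _ (inj₂ (inj₂ refl)) vw
        with at-most-two-neighbours (proj₁ ε₀-forced) (proj₂ ε₀-forced) (λ ()) vw
      ... | inj₁ refl = inj₂ (inj₁ (inj₁ refl))
      ... | inj₂ refl = inj₂ (inj₁ (inj₂ refl))

      no-chain : ∀ a → ¬ OnCycle (chain a)
      no-chain a (i , Wi≡) with core-on-C σ
      ... | iσ , Wiσ≡ = crossing (exit-point IsChain isChain? i iσ chain-i ¬chain-σ)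
                                 (entry-point IsChain isChain? i iσ chain-i ¬chain-σ)
        where
        chain-i : IsChain (W i)
        chain-i = subst IsChain (sym Wi≡) _

        ¬chain-σ : ¬ IsChain (W iσ)
        ¬chain-σ = subst (λ v → ¬ IsChain v) (sym Wiσ≡) λ ()

        sealed : ∀ {x y} → IsChain x → IsChain y → Consecutive (core κ₀) x → Consecutive (core α) y → ⊥
        sealed cx cy κ₀x αy = σ-outside (subst Region Wiσ≡ (closed⇒everywhere Region
          (λ j r → region-closed cx cy κ₀x αy r (consecutive-next j)) i (inj₁ chain-i) iσ))

        crossing : (∃ λ p → IsChain (W p) × ¬ IsChain (W (next p))) →
                   (∃ λ q → ¬ IsChain (W q) × IsChain (W (next q))) → ⊥
        crossing (p , cp , ¬cnp) (q , ¬cq , cnq)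
          with leaves-chain-through-gate cp ¬cnp (consecutive-next p)
             | leaves-chain-through-gate cnq ¬cq (consecutive-sym (consecutive-next q))
        ... | inj₁ np≡κ₀ | inj₁ q≡κ₀ = gate-used-once p q cp cnq (inj₁ np≡κ₀) (trans np≡κ₀ (sym q≡κ₀))
        ... | inj₂ np≡α  | inj₂ q≡α  = gate-used-once p q cp cnq (inj₂ np≡α) (trans np≡α (sym q≡α))
        ... | inj₁ np≡κ₀ | inj₂ q≡α  = sealed cp cnq (consecutive-back p np≡κ₀) (consecutive-forth q q≡α)
        ... | inj₂ np≡α  | inj₁ q≡κ₀ = sealed cnq cp (consecutive-forth q q≡κ₀) (consecutive-back p np≡α)

    all-or-nothing : (∀ j → ¬ OnCycle (chain j)) ⊎ (∀ j → OnCycle (chain j))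
    all-or-nothing with σ-switch | any? (λ j → onCycle? (chain j))
    ... | inj₁ σβ  | _            = inj₁ (SwitchAtEnd.no-chain σβ)
    ... | inj₂ σκ₀ | yes (_ , on) = inj₂ (SwitchAtCone.whole-chain σκ₀ on)
    ... | inj₂ _   | no  none     = inj₁ (λ j on → none (j , on))

  core-cycle⊆⇒core-covered : ∀ C → core-cycle ⊆V C → ∀ a → LabelledCycle.OnCycle C (core a)
  core-cycle⊆⇒core-covered C core⊆C a with coreCycle-surjective a
  ... | i , refl with core⊆C i
  ...   | j , eq = j , trans (cong (splitAt 15) eq) (splitAt-↑ˡ 15 (coreCycle i) (suc k))

  core-cycle-extensions : ∀ C → core-cycle ⊆V C → size C ≤ 15 ⊎ n ≤ size C
  core-cycle-extensions C core⊆C with CoreCovered.all-or-nothing C (core-cycle⊆⇒core-covered C core⊆C)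
  ... | inj₁ no-chain  = inj₁ (LabelledCycle.avoiding-chain⇒size≤15 C no-chain)
  ... | inj₂ all-chain = inj₂ (LabelledCycle.spanning⇒n≤size C on-C)
    where
    on-C : ∀ v → LabelledCycle.OnCycle C v
    on-C (core a)  = core-cycle⊆⇒core-covered C core⊆C a
    on-C (chain j) = all-chain j

  not-cycle-extendible : ∀ {S s₀} → s₀ ∈ S → All (λ s → 0 < s) S → All (λ s → s < suc k) S →
                         ¬ SCycleExtendible S G
  not-cycle-extendible s₀∈S positive short extend
    with extend core-cycle (_ , s₀∈S , +-monoʳ-≤ 15 (<⇒≤ (All-lookup short s₀∈S)))
  ... | C , core⊆C , s , s∈S , size≡ with core-cycle-extensions C core⊆C
  ...   | inj₁ size≤15 = <⇒≱ (All-lookup positive s∈S) (+-cancelˡ-≤ 15 s 0 (subst (_≤ 15) size≡ size≤15))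
  ...   | inj₂ n≤size  = <⇒≱ (All-lookup short s∈S) (+-cancelˡ-≤ 15 _ s (subst (n ≤_) size≡ n≤size))

∈⇒≤sum : ∀ {s S} → s ∈ S → s ≤ sum S
∈⇒≤sum {S = x ∷ xs} (here refl) = m≤m+n x (sum xs)
∈⇒≤sum {S = x ∷ xs} (there s∈) = ≤-trans (∈⇒≤sum s∈) (m≤n+m (sum xs) x)

theorem3p5 : (S : List ℕ) → S ≢ [] → All (λ s → 0 < s) S →
    (N : ℕ) → Σ ℕ λ n → N ≤ n × Σ (Graph n) λ G →
      Connected G × Chordal G × Hamiltonian G × ¬ SCycleExtendible S G
theorem3p5 []         S≢[] _        _ = ⊥-elim (S≢[] refl)
theorem3p5 S@(_ ∷ _) _    positive N =
  n , N≤n , G , along-next⇒connected G consecutive-indices-adjacent , chordal , (hamiltonian-cycle , refl) ,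
  not-cycle-extendible (here refl) positive (tabulate below-chain-length)
  where
  open Construction (N + sum S)

  N≤n : N ≤ n
  N≤n = ≤-trans (m≤m+n N (sum S)) (≤-trans (n≤1+n _) (m≤n+m _ 15))

  below-chain-length : ∀ {s} → s ∈ S → s < suc (N + sum S)
  below-chain-length s∈S = s≤s (≤-trans (∈⇒≤sum s∈S) (m≤n+m (sum S) N))
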